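{- Let $\mathcal{A}(n)$ denote the number of privileged factors of length $n$ of the Thue–Morse word $t$. Then $\limsup_{n\to\infty}\mathcal{A}(n)=\infty$ and $\liminf_{n\to\infty}\mathcal{A}(n)=0$.
   Context: The Thue–Morse word $t$ is the fixed point beginning with $0$ of the morphism $0\mapsto01,\ 1\mapsto10$. A complete first return to a word $v$ is a word that begins with $v$, ends with $v$, and contains exactly two occurrences of $v$. Privileged words: the empty word and every letter are privileged, and a word is privileged if it is a complete first return to a shorter privileged word. -}

module Defs where

open import Data.Bool using (Bool; true; false; not)
open import Data.Nat using (ℕ; zero; suc; _+_; _≤_; _<_)
open import Data.List using (List; []; _∷_; _++_; length; map; upTo; take; drop; concatMap)
open import Data.Fin using (Fin)
open import Data.Product using (Σ; ∃; _×_; _,_)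
open import Data.Sum using (_⊎_)
open import Relation.Binary.PropositionalEquality using (_≡_)
open import Relation.Nullary using (¬_)
open import Function.Definitions using (Injective)

-- Words over the alphabet {0,1}, encoded as Bool (false = 0, true = 1).
Word : Set
Word = List Bool

μ₁ : Bool → Word
μ₁ b = b ∷ not b ∷ []

μ : Word → Word
μ = concatMap μ₁

-- k-fold iterate μ^k(0); it has length 2^k and is a prefix of t.
μ^ : ℕ → Word
μ^ zero    = false ∷ []
μ^ (suc k) = μ (μ^ k)

-- n-th letter of a word (default only used out of range, never here).
nth : Word → ℕ → Bool
nth []       _       = false
nth (x ∷ _)  zero    = x
nth (_ ∷ xs) (suc n) = nth xs n

-- The Thue–Morse word t = lim μ^k(0), as a sequence ℕ → Bool:
-- t(n) is the n-th letter of μ^(n+1)(0), which has length 2^(n+1) > n.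
t : ℕ → Bool
t n = nth (μ^ (suc n)) n

window : ℕ → ℕ → Word
window i n = map (λ k → t (i + k)) (upTo n)

Factor : Word → Set
Factor w = ∃ λ i → window i (length w) ≡ w

OccursAt : Word → Word → ℕ → Set
OccursAt v w k = (k + length v ≤ length w) × (take (length v) (drop k w) ≡ v)

CompleteFirstReturn : Word → Word → Set
CompleteFirstReturn v w =
  (∃ λ u → v ++ u ≡ w) ×
  (∃ λ u → u ++ v ≡ w) ×
  (Σ ℕ λ i → Σ ℕ λ j → i < j × OccursAt v w i × OccursAt v w j ×
     (∀ k → OccursAt v w k → (k ≡ i) ⊎ (k ≡ j)))

data Privileged : Word → Set where
  priv-ε      : Privileged []
  priv-letter : (b : Bool) → Privileged (b ∷ [])
  priv-return : {v w : Word} → Privileged v → length v < length w →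
                CompleteFirstReturn v w → Privileged w

PrivFactor : ℕ → Word → Set
PrivFactor n w = (length w ≡ n) × Factor w × Privileged w

AtLeast : ℕ → ℕ → Set
AtLeast M n = Σ (Fin M → Word) λ f → Injective _≡_ _≡_ f × (∀ k → PrivFactor n (f k))

IsZero : ℕ → Set
IsZero n = ∀ w → ¬ PrivFactor n w

-- Both halves rest on the recognizability of the Thue–Morse morphism: two occurrences of a factor
-- of length at least 4 lie at even distance, and of length at least 8 at distance divisible by 4.
-- Hence first returns survive μ²: if the factor of length n at i first returns after g letters, then
-- the factor of length about 4n at 4i + c first returns after 4g letters, since every return of the
-- longer factor is pulled back along μ².
--
-- Unbounded 𝒜(n): chains of first returns that start from a few explicitly checked privileged seeds
-- lift from position i to 4i + 3, and chains from the seeds 011 and 100 lift from 0 to 0. Iterating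
-- yields, for every k, privileged factors of length 2·4^k + 2 at the k positions 0, 3, 15, …, 4^(k−1) − 1,
-- which are pairwise distinct since factors at positions 0 and 3 modulo 4 never agree on 8 letters.
--
-- 𝒜(n) = 0 for every odd n ≥ 5: a privileged factor w is a complete first return to a privileged v.
-- If |v| ≥ 4 the return gap is even, so |v| is again odd and at least 5. Short v are excluded
-- directly: a letter returns within 3 letters, the pairs aa sit at odd positions only, and between
-- two occurrences of aba at even distance there is a third.

module Submission where

open import Data.Bool using (Bool; true; false; not; _xor_)
open import Data.Bool.Properties using (not-involutive; not-injective; not-¬; ¬-not) renaming (_≟_ to _≟ᵇ_)
open import Data.Empty using (⊥-elim)
open import Data.Fin using (Fin; toℕ)
open import Data.Fin.Properties using (toℕ-injective; toℕ<n)
open import Data.List using (List; []; _∷_; _++_; length; map; take; drop; applyUpTo)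
open import Data.List.Properties
  using (length-++; ++-assoc; ++-identityʳ; map-applyUpTo; ∷-injectiveˡ; ∷-injectiveʳ; ≡-dec; take-all;
         take++drop≡id; length-drop)
open import Data.Nat
  using (ℕ; zero; suc; _+_; _*_; _∸_; _/_; _%_; _^_; _<?_; _≤?_; _≟_; _<ᵇ_; _≤_; _<_; z≤n; s≤s; z<s; s<s;
         _≤′_; ≤′-refl; ≤′-step)
open import Data.Nat.Properties
open import Data.Nat.DivMod using (m≡m%n+[m/n]*n; m%n<n; m<n*o⇒m/o<n)
open import Data.Nat.Tactic.RingSolver using (solve-∀)
open import Data.Product using (Σ; ∃; _×_; _,_; proj₁)
open import Data.Sum using (_⊎_; inj₁; inj₂; swap)
open import Function using (id)
open import Function.Definitions using (Injective)
open import Relation.Binary.PropositionalEquality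
open import Relation.Nullary using (¬_; Dec; yes; no)
open import Relation.Nullary.Decidable using (True; toWitness; _×-dec_; _→-dec_)

open import Defs


-- The recurrences t (2x) ≡ t x and t (2x + 1) ≡ not (t x)

length-μ : ∀ w → length (μ w) ≡ 2 * length w
length-μ []      = refl
length-μ (x ∷ w) = cong suc (trans (cong suc (length-μ w)) (sym (+-suc (length w) _)))

μ-++ : ∀ u v → μ (u ++ v) ≡ μ u ++ μ v
μ-++ []      v = refl
μ-++ (x ∷ u) v = cong (λ r → x ∷ not x ∷ r) (μ-++ u v)

nth-++ˡ : ∀ u v {n} → n < length u → nth (u ++ v) n ≡ nth u n
nth-++ˡ (x ∷ u) v {zero}  _         = refl
nth-++ˡ (x ∷ u) v {suc n} (s≤s n<) = nth-++ˡ u v n<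

nth-μ-even : ∀ w m → nth (μ w) (2 * m) ≡ nth w m
nth-μ-even []      zero    = refl
nth-μ-even []      (suc m) = refl
nth-μ-even (x ∷ w) zero    = refl
nth-μ-even (x ∷ w) (suc m) =
  subst (λ k → nth (not x ∷ μ w) k ≡ nth w m) (sym (+-suc m (m + 0))) (nth-μ-even w m)

nth-μ-odd : ∀ w m → m < length w → nth (μ w) (suc (2 * m)) ≡ not (nth w m)
nth-μ-odd (x ∷ w) zero    _         = refl
nth-μ-odd (x ∷ w) (suc m) (s≤s m<) =
  subst (λ k → nth (μ w) k ≡ not (nth w m)) (sym (+-suc m (m + 0))) (nth-μ-odd w m m<)

μ^-prefix-suc : ∀ k → ∃ λ r → μ^ k ++ r ≡ μ^ (suc k)
μ^-prefix-suc zero    = true ∷ [] , refl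
μ^-prefix-suc (suc k) with μ^-prefix-suc k
... | r , eq = μ r , trans (sym (μ-++ (μ^ k) r)) (cong μ eq)

μ^-prefix : ∀ {k K} → k ≤′ K → ∃ λ r → μ^ k ++ r ≡ μ^ K
μ^-prefix ≤′-refl = [] , ++-identityʳ _
μ^-prefix {k} (≤′-step {K} k≤K) with μ^-prefix k≤K | μ^-prefix-suc K
... | r , eq | s , eq′ = r ++ s , trans (sym (++-assoc (μ^ k) r s)) (trans (cong (_++ s) eq) eq′)

nth-prefix : ∀ {u w} → (∃ λ r → u ++ r ≡ w) → ∀ {n} → n < length u → nth w n ≡ nth u n
nth-prefix {u} (r , refl) = nth-++ˡ u r

n<∣μ^n∣ : ∀ n → n < length (μ^ n)
n<∣μ^n∣ zero    = s≤s z≤n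
n<∣μ^n∣ (suc n) = subst (suc n <_) (sym (length-μ (μ^ n)))
  (+-mono-≤ (≤-trans (s≤s z≤n) n<) (≤-trans n< (m≤m+n (length (μ^ n)) 0)))
  where n< = n<∣μ^n∣ n

n<∣μ^1+n∣ : ∀ n → n < length (μ^ (suc n))
n<∣μ^1+n∣ n = <-trans (n<1+n n) (n<∣μ^n∣ (suc n))

t≡nth-μ^ : ∀ K {n} → n < length (μ^ K) → t n ≡ nth (μ^ K) n
t≡nth-μ^ K {n} n< with ≤-total (suc n) K
... | inj₁ n<K = sym (nth-prefix (μ^-prefix (≤⇒≤′ n<K)) (n<∣μ^1+n∣ n))
... | inj₂ K≤n = nth-prefix (μ^-prefix (≤⇒≤′ K≤n)) n<

t-even : ∀ x → t (2 * x) ≡ t x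
t-even x = begin
  t (2 * x)                     ≡⟨ t≡nth-μ^ (suc (suc x)) 2x< ⟩
  nth (μ (μ^ (suc x))) (2 * x)  ≡⟨ nth-μ-even (μ^ (suc x)) x ⟩
  nth (μ^ (suc x)) x            ∎
  where
  open ≡-Reasoning
  2x< : 2 * x < length (μ (μ^ (suc x)))
  2x< = subst (2 * x <_) (sym (length-μ (μ^ (suc x)))) (*-monoʳ-< 2 (n<∣μ^1+n∣ x))

t-odd : ∀ x → t (suc (2 * x)) ≡ not (t x)
t-odd x = begin
  t (suc (2 * x))                     ≡⟨ t≡nth-μ^ (suc (suc x)) 2x+1< ⟩
  nth (μ (μ^ (suc x))) (suc (2 * x))  ≡⟨ nth-μ-odd (μ^ (suc x)) x (n<∣μ^1+n∣ x) ⟩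
  not (nth (μ^ (suc x)) x)            ∎
  where
  open ≡-Reasoning
  2x+1< : suc (2 * x) < length (μ (μ^ (suc x)))
  2x+1< = subst₂ _≤_ (*-suc 2 x) (sym (length-μ (μ^ (suc x)))) (*-monoʳ-≤ 2 (n<∣μ^1+n∣ x))

t-2x+r : ∀ x r → r < 2 → t (2 * x + r) ≡ t r xor t x
t-2x+r x 0 _ = trans (cong t (+-identityʳ (2 * x))) (t-even x)
t-2x+r x 1 _ = trans (cong t (+-comm (2 * x) 1)) (t-odd x)
t-2x+r x (suc (suc r)) (s≤s (s≤s ()))

t-4x+r : ∀ x r → r < 4 → t (4 * x + r) ≡ t r xor t x
t-4x+r x 0 _ = begin
  t (4 * x + 0)         ≡⟨ cong t (position x) ⟩
  t (2 * (2 * x))       ≡⟨ t-even (2 * x) ⟩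
  t (2 * x)             ≡⟨ t-even x ⟩
  t x                   ∎
  where
  open ≡-Reasoning
  position : ∀ x → 4 * x + 0 ≡ 2 * (2 * x)
  position = solve-∀
t-4x+r x 1 _ = begin
  t (4 * x + 1)         ≡⟨ cong t (position x) ⟩
  t (suc (2 * (2 * x))) ≡⟨ t-odd (2 * x) ⟩
  not (t (2 * x))       ≡⟨ cong not (t-even x) ⟩
  not (t x)             ∎
  where
  open ≡-Reasoning
  position : ∀ x → 4 * x + 1 ≡ suc (2 * (2 * x))
  position = solve-∀
t-4x+r x 2 _ = begin
  t (4 * x + 2)         ≡⟨ cong t (position x) ⟩
  t (2 * suc (2 * x))   ≡⟨ t-even (suc (2 * x)) ⟩
  t (suc (2 * x))       ≡⟨ t-odd x ⟩
  not (t x)             ∎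
  where
  open ≡-Reasoning
  position : ∀ x → 4 * x + 2 ≡ 2 * suc (2 * x)
  position = solve-∀
t-4x+r x 3 _ = begin
  t (4 * x + 3)             ≡⟨ cong t (position x) ⟩
  t (suc (2 * suc (2 * x))) ≡⟨ t-odd (suc (2 * x)) ⟩
  not (t (suc (2 * x)))     ≡⟨ cong not (t-odd x) ⟩
  not (not (t x))           ≡⟨ not-involutive (t x) ⟩
  t x                       ∎
  where
  open ≡-Reasoning
  position : ∀ x → 4 * x + 3 ≡ suc (2 * suc (2 * x))
  position = solve-∀
t-4x+r x (suc (suc (suc (suc r)))) (s≤s (s≤s (s≤s (s≤s ()))))

t-4x+s : ∀ x s → t (4 * x + s) ≡ t (s % 4) xor t (x + s / 4)
t-4x+s x s = begin
  t (4 * x + s)                   ≡⟨ cong (λ s → t (4 * x + s)) (m≡m%n+[m/n]*n s 4) ⟩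
  t (4 * x + (s % 4 + s / 4 * 4)) ≡⟨ cong t (position x (s % 4) (s / 4)) ⟩
  t (4 * (x + s / 4) + s % 4)     ≡⟨ t-4x+r (x + s / 4) (s % 4) (m%n<n s 4) ⟩
  t (s % 4) xor t (x + s / 4)     ∎
  where
  open ≡-Reasoning
  position : ∀ x r q → 4 * x + (r + q * 4) ≡ 4 * (x + q) + r
  position = solve-∀

xor-cancelˡ : ∀ b {x y} → b xor x ≡ b xor y → x ≡ y
xor-cancelˡ false eq = eq
xor-cancelˡ true  eq = not-injective eq


-- Factors of t and agreement of two factors

factor : ℕ → ℕ → Word
factor i zero    = []
factor i (suc n) = t i ∷ factor (suc i) n

applyUpTo≡factor : ∀ {f} i n → (∀ k → f k ≡ t (i + k)) → applyUpTo f n ≡ factor i n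
applyUpTo≡factor i zero    f≗ = refl
applyUpTo≡factor i (suc n) f≗ = cong₂ _∷_ (trans (f≗ 0) (cong t (+-identityʳ i)))
  (applyUpTo≡factor (suc i) n (λ k → trans (f≗ (suc k)) (cong t (+-suc i k))))

window≡factor : ∀ i n → window i n ≡ factor i n
window≡factor i n = trans (map-applyUpTo id (λ k → t (i + k)) n) (applyUpTo≡factor i n (λ _ → refl))

length-factor : ∀ i n → length (factor i n) ≡ n
length-factor i zero    = refl
length-factor i (suc n) = cong suc (length-factor (suc i) n)

factor-+ : ∀ i m n → factor i (m + n) ≡ factor i m ++ factor (i + m) n
factor-+ i zero    n = cong (λ j → factor j n) (sym (+-identityʳ i))
factor-+ i (suc m) n = cong (t i ∷_)
  (trans (factor-+ (suc i) m n) (cong (λ j → factor (suc i) m ++ factor j n) (sym (+-suc i m))))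

take-factor : ∀ i {m n} → m ≤ n → take m (factor i n) ≡ factor i m
take-factor i {zero}            _        = refl
take-factor i {suc m} {suc n} (s≤s m≤n) = cong (t i ∷_) (take-factor (suc i) m≤n)

drop-factor : ∀ i k n → drop k (factor i n) ≡ factor (i + k) (n ∸ k)
drop-factor i zero    n       = cong (λ j → factor j n) (sym (+-identityʳ i))
drop-factor i (suc k) zero    = refl
drop-factor i (suc k) (suc n) =
  trans (drop-factor (suc i) k n) (cong (λ j → factor j (n ∸ k)) (sym (+-suc i k)))

take-drop-factor : ∀ i {k n N} → k + n ≤ N → take n (drop k (factor i N)) ≡ factor (i + k) n
take-drop-factor i {k} {n} {N} k+n≤N = begin
  take n (drop k (factor i N))    ≡⟨ cong (take n) (drop-factor i k N) ⟩
  take n (factor (i + k) (N ∸ k)) ≡⟨ take-factor (i + k) n≤N∸k ⟩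
  factor (i + k) n                ∎
  where
  open ≡-Reasoning
  n≤N∸k : n ≤ N ∸ k
  n≤N∸k = subst (_≤ N ∸ k) (m+n∸m≡n k n) (∸-monoˡ-≤ k k+n≤N)

factor-μ : ∀ x n → factor (2 * x) (2 * n) ≡ μ (factor x n)
factor-μ x zero    = refl
factor-μ x (suc n) = begin
  factor (2 * x) (2 * suc n)                                ≡⟨ cong (factor (2 * x)) (*-suc 2 n) ⟩
  t (2 * x) ∷ t (suc (2 * x)) ∷ factor (2 + 2 * x) (2 * n)  ≡⟨ cong₂ _∷_ (t-even x)
                                                               (cong₂ _∷_ (t-odd x) tail) ⟩
  t x ∷ not (t x) ∷ μ (factor (suc x) n)                    ∎
  where
  open ≡-Reasoning
  tail : factor (2 + 2 * x) (2 * n) ≡ μ (factor (suc x) n)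
  tail = trans (cong (λ j → factor j (2 * n)) (sym (*-suc 2 x))) (factor-μ (suc x) n)

t-resp : ∀ {x y x′ y′} → x ≡ x′ → y ≡ y′ → t x ≡ t y → t x′ ≡ t y′
t-resp refl refl eq = eq

record Agree (p q n : ℕ) : Set where
  constructor agree
  field at : ∀ k → k < n → t (p + k) ≡ t (q + k)
open Agree

Agree-at : ∀ {p q n k x y} → Agree p q n → k < n → p + k ≡ x → q + k ≡ y → t x ≡ t y
Agree-at A k<n p+k≡x q+k≡y = t-resp p+k≡x q+k≡y (at A _ k<n)

Agree-sym : ∀ {p q n} → Agree p q n → Agree q p n
Agree-sym A = agree λ k k<n → sym (at A k k<n)

Agree-≤ : ∀ {p q m n} → m ≤ n → Agree p q n → Agree p q m
Agree-≤ m≤n A = agree λ k k<m → at A k (<-≤-trans k<m m≤n)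

Agree-cong : ∀ {p q p′ q′ n} → p ≡ p′ → q ≡ q′ → Agree p q n → Agree p′ q′ n
Agree-cong refl refl A = A

Agree-1 : ∀ p q → t p ≡ t q → Agree p q 1
Agree-1 p q eq = agree λ { zero _ → t-resp (sym (+-identityʳ p)) (sym (+-identityʳ q)) eq ; (suc _) (s≤s ()) }

Agree-refl : ∀ p n → Agree p p n
Agree-refl p n = agree λ _ _ → refl

factor≡⇒Agree : ∀ {p q} n → factor p n ≡ factor q n → Agree p q n
factor≡⇒Agree zero    _  = agree λ _ ()
factor≡⇒Agree {p} {q} (suc n) eq = agree λ
  { zero    _         → t-resp (sym (+-identityʳ p)) (sym (+-identityʳ q)) (∷-injectiveˡ eq)
  ; (suc k) (s≤s k<n) → t-resp (sym (+-suc p k)) (sym (+-suc q k))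
                          (at (factor≡⇒Agree n (∷-injectiveʳ eq)) k k<n) }

Agree⇒factor≡ : ∀ {p q n} → Agree p q n → factor p n ≡ factor q n
Agree⇒factor≡ {n = zero}      A = refl
Agree⇒factor≡ {p} {q} {suc n} A = cong₂ _∷_ (Agree-at A (s≤s z≤n) (+-identityʳ p) (+-identityʳ q))
  (Agree⇒factor≡ (agree λ k k<n → Agree-at A (s≤s k<n) (+-suc p k) (+-suc q k)))


-- Recognizability: long factors recur only at even distances, resp. multiples of 4

data Parity : ℕ → Set where
  even : ∀ m → Parity (2 * m)
  odd  : ∀ m → Parity (suc (2 * m))

parity : ∀ n → Parity n
parity zero = even 0
parity (suc n) with parity n
... | even m = odd m
... | odd m  = subst Parity (*-suc 2 m) (even (suc m))

pair⇒odd : ∀ y → t y ≡ t (suc y) → ∃ λ m → y ≡ suc (2 * m)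
pair⇒odd y pair with parity y
... | even m = ⊥-elim (not-¬ refl (trans (sym (t-even m)) (trans pair (t-odd m))))
... | odd m  = m , refl

no-aaa : ∀ b → t b ≡ t (suc b) → t (suc b) ≢ t (suc (suc b))
no-aaa b pair₁ pair₂ with pair⇒odd b pair₁ | pair⇒odd (suc b) pair₂
... | m , refl | m′ , eq = even≢odd (suc m) m′ (trans (*-suc 2 m) eq)

Agree-even-odd⇒pairs : ∀ {a b n} → Agree (2 * a) (suc (2 * b)) (2 * n) →
                        ∀ k → k < n → t (b + k) ≡ t (suc (b + k))
Agree-even-odd⇒pairs {a} {b} {n} A k k<n = begin
  t (b + k)             ≡⟨ sym (not-involutive _) ⟩
  not (not (t (b + k))) ≡⟨ cong not (sym even-offset) ⟩
  not (t (a + k))       ≡⟨ odd-offset ⟩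
  t (suc (b + k))       ∎
  where
  open ≡-Reasoning
  even-offset : t (a + k) ≡ not (t (b + k))
  even-offset = begin
    t (a + k)             ≡⟨ sym (t-even (a + k)) ⟩
    t (2 * (a + k))       ≡⟨ Agree-at A (*-monoʳ-< 2 k<n) (sym (*-distribˡ-+ 2 a k))
                                        (cong suc (sym (*-distribˡ-+ 2 b k))) ⟩
    t (suc (2 * (b + k))) ≡⟨ t-odd (b + k) ⟩
    not (t (b + k))       ∎
  odd-offset : not (t (a + k)) ≡ t (suc (b + k))
  odd-offset = begin
    not (t (a + k))       ≡⟨ sym (t-odd (a + k)) ⟩
    t (suc (2 * (a + k))) ≡⟨ Agree-at A (subst (_≤ 2 * n) (*-suc 2 k) (*-monoʳ-≤ 2 k<n))
                                        (trans (+-suc (2 * a) (2 * k)) (cong suc (sym (*-distribˡ-+ 2 a k))))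
                                        (shift b k) ⟩
    t (2 * suc (b + k))   ≡⟨ t-even (suc (b + k)) ⟩
    t (suc (b + k))       ∎
    where
    shift : ∀ b k → suc (2 * b) + suc (2 * k) ≡ 2 * suc (b + k)
    shift = solve-∀

¬Agree-even-odd : ∀ a b → ¬ Agree (2 * a) (suc (2 * b)) 4
¬Agree-even-odd a b A = no-aaa b (subst (λ x → t x ≡ t (suc x)) (+-identityʳ b) (pairs 0 (s≤s z≤n)))
                                 (subst (λ x → t x ≡ t (suc x)) (+-comm b 1) (pairs 1 (s≤s (s≤s z≤n))))
  where pairs = Agree-even-odd⇒pairs {a} {b} {2} A

period-even : ∀ p g → Agree (p + g) p 4 → ∃ λ h → g ≡ 2 * h
period-even p g A with parity g
... | even h = h , refl
... | odd h with parity p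
...   | even m = ⊥-elim (¬Agree-even-odd m (m + h) (Agree-cong refl (shift m h) (Agree-sym A)))
  where
  shift : ∀ m h → 2 * m + suc (2 * h) ≡ suc (2 * (m + h))
  shift = solve-∀
...   | odd m  = ⊥-elim (¬Agree-even-odd (suc (m + h)) m (Agree-cong (shift m h) refl A))
  where
  shift : ∀ m h → suc (2 * m) + suc (2 * h) ≡ 2 * suc (m + h)
  shift = solve-∀

Agree-half : ∀ {x y n} → Agree (2 * x) (2 * y) (2 * n) → Agree x y n
Agree-half {x} {y} A = agree λ k k<n → begin
  t (x + k)       ≡⟨ sym (t-even (x + k)) ⟩
  t (2 * (x + k)) ≡⟨ Agree-at A (*-monoʳ-< 2 k<n) (sym (*-distribˡ-+ 2 x k)) (sym (*-distribˡ-+ 2 y k)) ⟩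
  t (2 * (y + k)) ≡⟨ t-even (y + k) ⟩
  t (y + k)       ∎
  where open ≡-Reasoning

Agree-half-odd : ∀ {x y n} → Agree (suc (2 * x)) (suc (2 * y)) (2 * n) → Agree (suc x) (suc y) n
Agree-half-odd {x} {y} {n} A = agree λ k k<n → begin
  t (suc x + k)       ≡⟨ sym (t-even (suc x + k)) ⟩
  t (2 * (suc x + k)) ≡⟨ Agree-at A (subst (_≤ 2 * n) (*-suc 2 k) (*-monoʳ-≤ 2 k<n)) (shift x k) (shift y k) ⟩
  t (2 * (suc y + k)) ≡⟨ t-even (suc y + k) ⟩
  t (suc y + k)       ∎
  where
  open ≡-Reasoning
  shift : ∀ x k → suc (2 * x) + suc (2 * k) ≡ 2 * (suc x + k)
  shift = solve-∀

period-multiple-of-4 : ∀ p g → Agree (p + g) p 8 → ∃ λ h → g ≡ 4 * h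
period-multiple-of-4 p g A with period-even p g (Agree-≤ (s≤s (s≤s (s≤s (s≤s z≤n)))) A)
... | h , refl with parity p
...   | even m with period-even m h (Agree-half (Agree-cong (sym (*-distribˡ-+ 2 m h)) refl A))
...     | h′ , refl = h′ , sym (*-assoc 2 2 h′)
period-multiple-of-4 p g A | h , refl | odd m
  with period-even (suc m) h (Agree-half-odd (Agree-cong (cong suc (sym (*-distribˡ-+ 2 m h))) refl A))
...     | h′ , refl = h′ , sym (*-assoc 2 2 h′)

Agree-μ² : ∀ {x y n c n′} → c + n′ ≤ 4 * n → Agree x y n → Agree (4 * x + c) (4 * y + c) n′
Agree-μ² {x} {y} {n} {c} {n′} c+n′≤4n A = agree λ k k<n′ → begin
  t (4 * x + c + k)                         ≡⟨ cong t (+-assoc (4 * x) c k) ⟩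
  t (4 * x + (c + k))                       ≡⟨ t-4x+s x (c + k) ⟩
  t ((c + k) % 4) xor t (x + (c + k) / 4)   ≡⟨ cong (t ((c + k) % 4) xor_) (at A _ (block< k<n′)) ⟩
  t ((c + k) % 4) xor t (y + (c + k) / 4)   ≡⟨ sym (t-4x+s y (c + k)) ⟩
  t (4 * y + (c + k))                       ≡⟨ cong t (sym (+-assoc (4 * y) c k)) ⟩
  t (4 * y + c + k)                         ∎
  where
  open ≡-Reasoning
  block< : ∀ {k} → k < n′ → (c + k) / 4 < n
  block< {k} k<n′ = m<n*o⇒m/o<n (subst (c + k <_) (*-comm 4 n) (<-≤-trans (+-monoʳ-< c k<n′) c+n′≤4n))

Agree-unμ² : ∀ {x y n c n′} → c ≤ 3 → 4 * n ≤ 3 + (c + n′) → 0 < n′ →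
             Agree (4 * x + c) (4 * y + c) n′ → Agree x y n
Agree-unμ² {x} {y} {n} {c} {n′} c≤3 4n≤3+c+n′ 0<n′ A = agree block
  where
  -- Block m > 0 is read off at its first letter, offset 4m ∸ c; block 0 only through the letter
  -- at offset 0, which is t c xor t x.
  c<4 : c < 4
  c<4 = s≤s c≤3
  block : ∀ m → m < n → t (x + m) ≡ t (y + m)
  block zero _ = t-resp (sym (+-identityʳ x)) (sym (+-identityʳ y)) (xor-cancelˡ (t c) (begin
    t c xor t x    ≡⟨ sym (t-4x+r x c c<4) ⟩
    t (4 * x + c)  ≡⟨ Agree-at A 0<n′ (+-identityʳ _) (+-identityʳ _) ⟩
    t (4 * y + c)  ≡⟨ t-4x+r y c c<4 ⟩
    t c xor t y    ∎))
    where open ≡-Reasoning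
  block (suc m) m<n = begin
    t (x + suc m)               ≡⟨ sym (t-4x+r (x + suc m) 0 (s≤s z≤n)) ⟩
    t (4 * (x + suc m) + 0)     ≡⟨ Agree-at A k<n′ (position x) (position y) ⟩
    t (4 * (y + suc m) + 0)     ≡⟨ t-4x+r (y + suc m) 0 (s≤s z≤n) ⟩
    t (y + suc m)               ∎
    where
    open ≡-Reasoning
    k = 4 * suc m ∸ c
    c+k : c + k ≡ 4 * suc m
    c+k = m+[n∸m]≡n (≤-trans c≤3 (≤-trans (n≤1+n 3) (subst (4 ≤_) (sym (*-suc 4 m)) (m≤m+n 4 (4 * m)))))
    position : ∀ z → 4 * z + c + k ≡ 4 * (z + suc m) + 0
    position z = begin
      4 * z + c + k         ≡⟨ +-assoc (4 * z) c k ⟩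
      4 * z + (c + k)       ≡⟨ cong (4 * z +_) c+k ⟩
      4 * z + 4 * suc m     ≡⟨ shift z m ⟩
      4 * (z + suc m) + 0   ∎
      where
      shift : ∀ z m → 4 * z + 4 * suc m ≡ 4 * (z + suc m) + 0
      shift = solve-∀
    k<n′ : k < n′
    k<n′ = +-cancelˡ-< c k n′ (subst (_< c + n′) (sym c+k)
             (+-cancelˡ-≤ 3 _ _ (≤-trans (subst (_≤ 4 * n) (next-block m) (*-monoʳ-≤ 4 m<n)) 4n≤3+c+n′)))
      where
      next-block : ∀ m → 4 * suc (suc m) ≡ 3 + suc (4 * suc m)
      next-block = solve-∀


-- First returns

record FirstReturn (i n g : ℕ) : Set where
  field
    gap>0   : 0 < g
    returns : Agree (i + g) i n
    first   : ∀ k → k ≤ g → Agree (i + k) i n → k ≡ 0 ⊎ k ≡ g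
open FirstReturn

FirstReturn-μ² : ∀ {i n g c n′} → c ≤ 3 → c + n′ ≤ 4 * n → 4 * n ≤ 3 + (c + n′) → 8 ≤ n′ →
                 FirstReturn i n g → FirstReturn (4 * i + c) n′ (4 * g)
FirstReturn-μ² {i} {g = g} {c} {n′} c≤3 c+n′≤4n 4n≤3+c+n′ 8≤n′ R = record
  { gap>0   = *-monoʳ-< 4 (gap>0 R)
  ; returns = Agree-cong (position g) refl (Agree-μ² c+n′≤4n (returns R))
  ; first   = only
  }
  where
  position : ∀ q → 4 * (i + q) + c ≡ 4 * i + c + 4 * q
  position q = shift i q c
    where
    shift : ∀ i q c → 4 * (i + q) + c ≡ 4 * i + c + 4 * q
    shift = solve-∀
  only : ∀ k → k ≤ 4 * g → Agree (4 * i + c + k) (4 * i + c) n′ → k ≡ 0 ⊎ k ≡ 4 * g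
  only k k≤4g A with period-multiple-of-4 (4 * i + c) k (Agree-≤ 8≤n′ A)
  ... | q , refl with first R q (*-cancelˡ-≤ 4 k≤4g)
                     (Agree-unμ² c≤3 4n≤3+c+n′ (<-≤-trans (s≤s z≤n) 8≤n′) (Agree-cong (sym (position q)) refl A))
  ...   | inj₁ refl = inj₁ refl
  ...   | inj₂ refl = inj₂ refl

take-++ : ∀ (u v : Word) → take (length u) (u ++ v) ≡ u
take-++ []      v = refl
take-++ (x ∷ u) v = cong (x ∷_) (take-++ u v)

drop-++ : ∀ (u v : Word) → drop (length u) (u ++ v) ≡ v
drop-++ []      v = refl
drop-++ (x ∷ u) v = drop-++ u v

Agree⇒OccursAt : ∀ {i n N k} → k + n ≤ N → Agree (i + k) i n → OccursAt (factor i n) (factor i N) k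
Agree⇒OccursAt {i} {n} {N} k+n≤N A rewrite length-factor i n | length-factor i N =
  k+n≤N , trans (take-drop-factor i k+n≤N) (Agree⇒factor≡ A)

OccursAt⇒Agree : ∀ {i n N k} → OccursAt (factor i n) (factor i N) k → k + n ≤ N × Agree (i + k) i n
OccursAt⇒Agree {i} {n} {N} occ with occ
... | k+n≤N , eq rewrite length-factor i n | length-factor i N =
  k+n≤N , factor≡⇒Agree n (trans (sym (take-drop-factor i k+n≤N)) eq)

FirstReturn⇒CFR : ∀ {i n g} → FirstReturn i n g → CompleteFirstReturn (factor i n) (factor i (n + g))
FirstReturn⇒CFR {i} {n} {g} R =
  (factor (i + n) g , sym (factor-+ i n g)) ,
  (factor i g , suffix) ,
  (0 , g , gap>0 R , Agree⇒OccursAt (m≤m+n n g) (Agree-cong (sym (+-identityʳ i)) refl (Agree-refl i n)) ,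
   Agree⇒OccursAt (≤-reflexive (+-comm g n)) (returns R) , only)
  where
  suffix : factor i g ++ factor i n ≡ factor i (n + g)
  suffix = begin
    factor i g ++ factor i n        ≡⟨ cong (factor i g ++_) (sym (Agree⇒factor≡ (returns R))) ⟩
    factor i g ++ factor (i + g) n  ≡⟨ sym (factor-+ i g n) ⟩
    factor i (g + n)                ≡⟨ cong (factor i) (+-comm g n) ⟩
    factor i (n + g)                ∎
    where open ≡-Reasoning
  only : ∀ k → OccursAt (factor i n) (factor i (n + g)) k → k ≡ 0 ⊎ k ≡ g
  only k occ with OccursAt⇒Agree occ
  ... | k+n≤n+g , A = first R k (+-cancelʳ-≤ n k g (subst (k + n ≤_) (+-comm n g) k+n≤n+g)) A

xy∈ab⇒ab∈xy : ∀ {a b x y k : ℕ} → x < y → x ≡ a ⊎ x ≡ b → y ≡ a ⊎ y ≡ b →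
                         k ≡ a ⊎ k ≡ b → k ≡ x ⊎ k ≡ y
xy∈ab⇒ab∈xy x<y (inj₁ refl) (inj₁ refl) _ = ⊥-elim (<-irrefl refl x<y)
xy∈ab⇒ab∈xy x<y (inj₂ refl) (inj₂ refl) _ = ⊥-elim (<-irrefl refl x<y)
xy∈ab⇒ab∈xy x<y (inj₁ refl) (inj₂ refl) k = k
xy∈ab⇒ab∈xy x<y (inj₂ refl) (inj₁ refl) k = swap k

CFR⇒shorter : ∀ {v w} → CompleteFirstReturn v w → length v < length w
CFR⇒shorter {v} (_ , _ , (_ , j , i<j , _ , (j+ℓ≤ , _) , _)) =
  <-≤-trans (m<n+m (length v) (≤-trans (s≤s z≤n) i<j)) j+ℓ≤

CFR⇒FirstReturn : ∀ {v i L} → CompleteFirstReturn v (factor i L) →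
                  factor i (length v) ≡ v × ∃ λ g → length v + g ≡ L × FirstReturn i (length v) g
CFR⇒FirstReturn {v} {i} {L} R@((u , v++u) , (u′ , u′++v) , (_ , _ , _ , _ , _ , only)) =
  prefix , g , ℓ+g≡L , record { gap>0 = 0<g ; returns = returns-at-g ; first = first-at }
  where
  ℓ = length v
  g = length u′
  ℓ<L : ℓ < L
  ℓ<L = subst (ℓ <_) (length-factor i L) (CFR⇒shorter R)
  ℓ+g≡L : ℓ + g ≡ L
  ℓ+g≡L = trans (+-comm ℓ g) (trans (sym (length-++ u′)) (trans (cong length u′++v) (length-factor i L)))
  prefix : factor i ℓ ≡ v
  prefix = begin
    factor i ℓ              ≡⟨ sym (take-factor i (<⇒≤ ℓ<L)) ⟩
    take ℓ (factor i L)     ≡⟨ cong (take ℓ) (sym v++u) ⟩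
    take ℓ (v ++ u)         ≡⟨ take-++ v u ⟩
    v                       ∎
    where open ≡-Reasoning
  suffix : factor (i + g) ℓ ≡ v
  suffix = begin
    factor (i + g) ℓ        ≡⟨ cong (factor (i + g)) (sym (trans (cong (_∸ g) (sym ℓ+g≡L)) (m+n∸n≡m ℓ g))) ⟩
    factor (i + g) (L ∸ g)  ≡⟨ sym (drop-factor i g L) ⟩
    drop g (factor i L)     ≡⟨ cong (drop g) (sym u′++v) ⟩
    drop g (u′ ++ v)        ≡⟨ drop-++ u′ v ⟩
    v                       ∎
    where open ≡-Reasoning
  0<g : 0 < g
  0<g = +-cancelˡ-< ℓ 0 g (subst₂ _<_ (sym (+-identityʳ ℓ)) (sym ℓ+g≡L) ℓ<L)
  returns-at-g : Agree (i + g) i ℓ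
  returns-at-g = factor≡⇒Agree ℓ (trans suffix (sym prefix))
  occurs : ∀ {k} → k ≤ g → Agree (i + k) i ℓ → OccursAt v (factor i L) k
  occurs {k} k≤g A = subst (λ w → OccursAt w (factor i L) k) prefix
    (Agree⇒OccursAt (subst (k + ℓ ≤_) (trans (+-comm g ℓ) ℓ+g≡L) (+-monoˡ-≤ ℓ k≤g)) A)
  first-at : ∀ k → k ≤ g → Agree (i + k) i ℓ → k ≡ 0 ⊎ k ≡ g
  first-at k k≤g A = xy∈ab⇒ab∈xy 0<g
    (only 0 (occurs z≤n (Agree-cong (sym (+-identityʳ i)) refl (Agree-refl i ℓ))))
    (only g (occurs ≤-refl returns-at-g))
    (only k (occurs k≤g A))

privileged-return : ∀ {v w} → Privileged v → CompleteFirstReturn v w → Privileged w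
privileged-return P R = priv-return P (CFR⇒shorter R) R

ReturnsFirstAtEnd : Word → Word → Set
ReturnsFirstAtEnd v w =
  0 < g × OccursAt v w 0 × OccursAt v w g × (∀ {k} → k < g → OccursAt v w k → k ≡ 0)
  where g = length w ∸ length v

returns-first-at-end? : ∀ v w → Dec (ReturnsFirstAtEnd v w)
returns-first-at-end? v w =
  (0 <? g) ×-dec occurs? 0 ×-dec occurs? g ×-dec
  allUpTo? (λ k → occurs? k →-dec (k ≟ 0)) g
  where
  g = length w ∸ length v
  occurs? : ∀ k → Dec (OccursAt v w k)
  occurs? k = (k + length v ≤? length w) ×-dec ≡-dec _≟ᵇ_ (take (length v) (drop k w)) v

ReturnsFirstAtEnd⇒CFR : ∀ {v w} → ReturnsFirstAtEnd v w → CompleteFirstReturn v w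
ReturnsFirstAtEnd⇒CFR {v} {w} (0<g , occ₀@(v≤w , prefix) , occ-g@(_ , suffix) , first) =
  (drop ℓ w , trans (cong (_++ drop ℓ w) (sym prefix)) (take++drop≡id ℓ w)) ,
  (take g w , trans (cong (take g w ++_) (trans (sym suffix) suffix′)) (take++drop≡id g w)) ,
  (0 , g , 0<g , occ₀ , occ-g , only)
  where
  ℓ = length v
  g = length w ∸ ℓ
  suffix′ : take ℓ (drop g w) ≡ drop g w
  suffix′ = take-all ℓ (drop g w) (≤-reflexive (trans (length-drop g w) (m∸[m∸n]≡n v≤w)))
  only : ∀ k → OccursAt v w k → k ≡ 0 ⊎ k ≡ g
  only k occ with m≤n⇒m<n∨m≡n (m+n≤o⇒m≤o∸n k (proj₁ occ))
  ... | inj₁ k<g = inj₁ (first k<g occ)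
  ... | inj₂ k≡g = inj₂ k≡g

complete-first-return : ∀ v w → {True (returns-first-at-end? v w)} → CompleteFirstReturn v w
complete-first-return v w {ok} = ReturnsFirstAtEnd⇒CFR (toWitness ok)

aba-privileged : ∀ a → Privileged (a ∷ not a ∷ a ∷ [])
aba-privileged false = privileged-return (priv-letter false) (complete-first-return _ _)
aba-privileged true  = privileged-return (priv-letter true) (complete-first-return _ _)


-- Chains of first returns and their lifting along μ²

lifted-factor : ∀ i c {n u n′} → factor i n ≡ u → c + n′ ≤ 4 * n →
                factor (4 * i + c) n′ ≡ take n′ (drop c (μ (μ u)))
lifted-factor i c {n} {n′ = n′} refl c+n′≤4n = begin
  factor (4 * i + c) n′                               ≡⟨ sym (take-drop-factor (4 * i) c+n′≤4n) ⟩
  take n′ (drop c (factor (4 * i) (4 * n)))           ≡⟨ cong (λ w → take n′ (drop c w)) μ² ⟩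
  take n′ (drop c (μ (μ (factor i n))))               ∎
  where
  open ≡-Reasoning
  μ² : factor (4 * i) (4 * n) ≡ μ (μ (factor i n))
  μ² = begin
    factor (4 * i) (4 * n)               ≡⟨ cong₂ factor (*-assoc 2 2 i) (*-assoc 2 2 n) ⟩
    factor (2 * (2 * i)) (2 * (2 * n))   ≡⟨ factor-μ (2 * i) (2 * n) ⟩
    μ (factor (2 * i) (2 * n))           ≡⟨ cong μ (factor-μ i n) ⟩
    μ (μ (factor i n))                   ∎

data Chain (Seed : Word → Set) (i : ℕ) : ℕ → Set where
  seed   : ∀ {u} → Seed u → factor i (length u) ≡ u → Chain Seed i (length u)
  extend : ∀ {n g} → Chain Seed i n → FirstReturn i n g → Chain Seed i (n + g)

Chain-seed : ∀ {Seed i n} → Chain Seed i n → ∃ λ u → Seed u × length u ≤ n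
Chain-seed (seed {u} s _) = u , s , ≤-refl
Chain-seed (extend {n} {g} ch _) with Chain-seed ch
... | u , s , u≤n = u , s , ≤-trans u≤n (m≤m+n n g)

Chain-privileged : ∀ {Seed i n} → (∀ {u} → Seed u → Privileged u) →
                   Chain Seed i n → Privileged (factor i n)
Chain-privileged seed-privileged (seed s eq)   = subst Privileged (sym eq) (seed-privileged s)
Chain-privileged seed-privileged (extend ch R) =
  privileged-return (Chain-privileged seed-privileged ch) (FirstReturn⇒CFR R)

seed-then-return : ∀ {Seed i n u w} → Seed u → factor i n ≡ w → CompleteFirstReturn u w → Chain Seed i n
seed-then-return {Seed} {i} s refl R with CFR⇒FirstReturn R
... | prefix , g , ℓ+g≡n , F = subst (Chain Seed i) ℓ+g≡n (extend (seed s prefix) F)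

-- μ² maps a chain at i of length n onto the window of length 4n at 4i; cutting offset letters in
-- front and trim − offset at the back leaves a chain again, once the lifted seeds are checked.
record Lifting (Seed Seed′ : Word → Set) : Set where
  field
    offset trim   : ℕ
    offset≤3      : offset ≤ 3
    offset≤trim   : offset ≤ trim
    trim≤3+offset : trim ≤ 3 + offset
    seed-long     : ∀ {u} → Seed u → 8 + trim ≤ 4 * length u
    lift-seed     : ∀ {i u n′} → Seed u → trim + n′ ≡ 4 * length u →
                    factor (4 * i + offset) n′ ≡ take n′ (drop offset (μ (μ u))) →
                    Chain Seed′ (4 * i + offset) n′

module _ {Seed Seed′ : Word → Set} (L : Lifting Seed Seed′) where
  open Lifting L

  Chain-lift : ∀ {i n n′} → Chain Seed i n → trim + n′ ≡ 4 * n → Chain Seed′ (4 * i + offset) n′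
  Chain-lift {i} {n′ = n′} (seed {u} s eq) e =
    lift-seed {i} {u} {n′} s e (lifted-factor i offset eq (≤-trans (+-monoˡ-≤ n′ offset≤trim) (≤-reflexive e)))
  Chain-lift {i} {n} {n′} (extend {n₀} {g} ch R) e =
    subst (Chain Seed′ (4 * i + offset)) b+4g≡n′ (extend (Chain-lift ch trim+b≡4n₀) R′)
    where
    long : 8 + trim ≤ 4 * n₀
    long with Chain-seed ch
    ... | u , s , u≤n₀ = ≤-trans (seed-long s) (*-monoʳ-≤ 4 u≤n₀)
    b = 4 * n₀ ∸ trim
    trim+b≡4n₀ : trim + b ≡ 4 * n₀
    trim+b≡4n₀ = m+[n∸m]≡n (≤-trans (m≤n+m trim 8) long)
    b+4g≡n′ : b + 4 * g ≡ n′
    b+4g≡n′ = +-cancelˡ-≡ trim _ _ (begin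
      trim + (b + 4 * g)  ≡⟨ sym (+-assoc trim b (4 * g)) ⟩
      trim + b + 4 * g    ≡⟨ cong (_+ 4 * g) trim+b≡4n₀ ⟩
      4 * n₀ + 4 * g      ≡⟨ sym (*-distribˡ-+ 4 n₀ g) ⟩
      4 * (n₀ + g)        ≡⟨ sym e ⟩
      trim + n′           ∎)
      where open ≡-Reasoning
    R′ : FirstReturn (4 * i + offset) b (4 * g)
    R′ = FirstReturn-μ² offset≤3
      (≤-trans (+-monoˡ-≤ b offset≤trim) (≤-reflexive trim+b≡4n₀))
      (≤-trans (≤-reflexive (sym trim+b≡4n₀)) (+-monoˡ-≤ b trim≤3+offset))
      (+-cancelˡ-≤ trim 8 b (≤-trans (subst (_≤ 4 * n₀) (+-comm 8 trim) long) (≤-reflexive (sym trim+b≡4n₀))))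
      R

binary : List ℕ → Word
binary = map (0 <ᵇ_)

data OddSeed : Word → Set where
  s₀₁₁ : OddSeed (binary (0 ∷ 1 ∷ 1 ∷ []))
  s₁₀₀ : OddSeed (binary (1 ∷ 0 ∷ 0 ∷ []))

data EvenSeed : Word → Set where
  s₀₁₁₀       : EvenSeed (binary (0 ∷ 1 ∷ 1 ∷ 0 ∷ []))
  s₁₀₀₁       : EvenSeed (binary (1 ∷ 0 ∷ 0 ∷ 1 ∷ []))
  s₀₁₀₀₁₀     : EvenSeed (binary (0 ∷ 1 ∷ 0 ∷ 0 ∷ 1 ∷ 0 ∷ []))
  s₁₀₁₁₀₁     : EvenSeed (binary (1 ∷ 0 ∷ 1 ∷ 1 ∷ 0 ∷ 1 ∷ []))
  s₀₁₀₀₁₁₀₀₁₀ : EvenSeed (binary (0 ∷ 1 ∷ 0 ∷ 0 ∷ 1 ∷ 1 ∷ 0 ∷ 0 ∷ 1 ∷ 0 ∷ []))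
  s₁₀₁₁₀₀₁₁₀₁ : EvenSeed (binary (1 ∷ 0 ∷ 1 ∷ 1 ∷ 0 ∷ 0 ∷ 1 ∷ 1 ∷ 0 ∷ 1 ∷ []))

EvenSeed-privileged : ∀ {u} → EvenSeed u → Privileged u
EvenSeed-privileged s₀₁₁₀       = privileged-return (priv-letter false) (complete-first-return _ _)
EvenSeed-privileged s₁₀₀₁       = privileged-return (priv-letter true) (complete-first-return _ _)
EvenSeed-privileged s₀₁₀₀₁₀     = privileged-return (aba-privileged false) (complete-first-return _ _)
EvenSeed-privileged s₁₀₁₁₀₁     = privileged-return (aba-privileged true) (complete-first-return _ _)
EvenSeed-privileged s₀₁₀₀₁₁₀₀₁₀ = privileged-return (aba-privileged false) (complete-first-return _ _)
EvenSeed-privileged s₁₀₁₁₀₀₁₁₀₁ = privileged-return (aba-privileged true) (complete-first-return _ _)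

odd-lifting : Lifting OddSeed OddSeed
odd-lifting = record
  { offset = 0 ; trim = 3 ; offset≤3 = z≤n ; offset≤trim = z≤n ; trim≤3+offset = ≤-refl
  ; seed-long = λ { s₀₁₁ → m≤m+n _ _ ; s₁₀₀ → m≤m+n _ _ }
  ; lift-seed = λ {i} → lift {i}
  }
  where
  lift : ∀ {i u n′} → OddSeed u → 3 + n′ ≡ 4 * length u →
         factor (4 * i + 0) n′ ≡ take n′ (drop 0 (μ (μ u))) → Chain OddSeed (4 * i + 0) n′
  lift s₀₁₁ refl lifted = seed-then-return s₀₁₁ lifted (complete-first-return _ _)
  lift s₁₀₀ refl lifted = seed-then-return s₁₀₀ lifted (complete-first-return _ _)

even-lifting : Lifting EvenSeed EvenSeed
even-lifting = record
  { offset = 3 ; trim = 6 ; offset≤3 = ≤-refl ; offset≤trim = m≤m+n 3 3 ; trim≤3+offset = ≤-refl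
  ; seed-long = λ { s₀₁₁₀ → m≤m+n _ _ ; s₁₀₀₁ → m≤m+n _ _ ; s₀₁₀₀₁₀ → m≤m+n _ _ ; s₁₀₁₁₀₁ → m≤m+n _ _
                  ; s₀₁₀₀₁₁₀₀₁₀ → m≤m+n _ _ ; s₁₀₁₁₀₀₁₁₀₁ → m≤m+n _ _ }
  ; lift-seed = λ {i} → lift {i}
  }
  where
  lift : ∀ {i u n′} → EvenSeed u → 6 + n′ ≡ 4 * length u →
         factor (4 * i + 3) n′ ≡ take n′ (drop 3 (μ (μ u))) → Chain EvenSeed (4 * i + 3) n′
  lift s₀₁₁₀       refl lifted = seed s₀₁₀₀₁₁₀₀₁₀ lifted
  lift s₁₀₀₁       refl lifted = seed s₁₀₁₁₀₀₁₁₀₁ lifted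
  lift s₀₁₀₀₁₀     refl lifted = seed-then-return s₀₁₀₀₁₀ lifted (complete-first-return _ _)
  lift s₁₀₁₁₀₁     refl lifted = seed-then-return s₁₀₁₁₀₁ lifted (complete-first-return _ _)
  lift s₀₁₀₀₁₁₀₀₁₀ refl lifted = seed-then-return s₀₁₀₀₁₀ lifted (complete-first-return _ _)
  lift s₁₀₁₁₀₀₁₁₀₁ refl lifted = seed-then-return s₁₀₁₁₀₁ lifted (complete-first-return _ _)

odd-even-lifting : Lifting OddSeed EvenSeed
odd-even-lifting = record
  { offset = 0 ; trim = 2 ; offset≤3 = z≤n ; offset≤trim = z≤n ; trim≤3+offset = n≤1+n 2
  ; seed-long = λ { s₀₁₁ → m≤m+n _ _ ; s₁₀₀ → m≤m+n _ _ }
  ; lift-seed = λ {i} → lift {i}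
  }
  where
  lift : ∀ {i u n′} → OddSeed u → 2 + n′ ≡ 4 * length u →
         factor (4 * i + 0) n′ ≡ take n′ (drop 0 (μ (μ u))) → Chain EvenSeed (4 * i + 0) n′
  lift s₀₁₁ refl lifted = seed-then-return s₀₁₁₀ lifted (complete-first-return _ _)
  lift s₁₀₀ refl lifted = seed-then-return s₁₀₀₁ lifted (complete-first-return _ _)


-- Many privileged factors of the same length

odd-chain : ∀ k → Chain OddSeed 0 (1 + 2 * 4 ^ k)
odd-chain zero    = seed s₀₁₁ refl
odd-chain (suc k) = Chain-lift odd-lifting (odd-chain k) (length-eq (4 ^ k))
  where
  length-eq : ∀ x → 3 + (1 + 2 * (4 * x)) ≡ 4 * (1 + 2 * x)
  length-eq = solve-∀

start : ℕ → ℕ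
start zero    = 0
start (suc j) = 4 * start j + 3

even-chain : ∀ k j → j < k → Chain EvenSeed (start j) (2 + 2 * 4 ^ k)
even-chain (suc k) zero    _         = Chain-lift odd-even-lifting (odd-chain k) (length-eq (4 ^ k))
  where
  length-eq : ∀ x → 2 + (2 + 2 * (4 * x)) ≡ 4 * (1 + 2 * x)
  length-eq = solve-∀
even-chain (suc k) (suc j) (s≤s j<k) = Chain-lift even-lifting (even-chain k j j<k) (length-eq (4 ^ k))
  where
  length-eq : ∀ x → 6 + (2 + 2 * (4 * x)) ≡ 4 * (2 + 2 * x)
  length-eq = solve-∀

4x≢4y+3 : ∀ x y → 4 * x ≢ 4 * y + 3
4x≢4y+3 x y eq = even≢odd (2 * x) (2 * y + 1) (trans (even-form x) (trans eq (odd-form y)))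
  where
  even-form : ∀ x → 2 * (2 * x) ≡ 4 * x
  even-form = solve-∀
  odd-form : ∀ y → 4 * y + 3 ≡ suc (2 * (2 * y + 1))
  odd-form = solve-∀

¬Agree-4a-4b+3 : ∀ a b → ¬ Agree (4 * a) (4 * b + 3) 8
¬Agree-4a-4b+3 a b A with ≤-total (4 * a) (4 * b + 3)
... | inj₁ 4a≤ with m≤n⇒∃[o]m+o≡n 4a≤
...   | d , eq with period-multiple-of-4 (4 * a) d (Agree-cong (sym eq) refl (Agree-sym A))
...     | h , refl = 4x≢4y+3 (a + h) b (trans (*-distribˡ-+ 4 a h) eq)
¬Agree-4a-4b+3 a b A | inj₂ ≤4a with m≤n⇒∃[o]m+o≡n ≤4a
...   | d , eq with period-multiple-of-4 (4 * b + 3) d (Agree-cong (sym eq) refl A)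
...     | h , refl = 4x≢4y+3 a (b + h) (sym (trans (shift b h) eq))
  where
  shift : ∀ b h → 4 * (b + h) + 3 ≡ 4 * b + 3 + 4 * h
  shift = solve-∀

8≤2+2*4^[1+k] : ∀ k → 8 ≤ 2 + 2 * 4 ^ suc k
8≤2+2*4^[1+k] k = ≤-trans (*-monoʳ-≤ 2 (*-monoʳ-≤ 4 (m^n>0 4 k))) (m≤n+m _ 2)

factors-at-starts-differ : ∀ k j j′ → j < k → j′ < k →
                           Agree (start j) (start j′) (2 + 2 * 4 ^ k) → j ≡ j′
factors-at-starts-differ (suc k) zero    zero     _         _          _ = refl
factors-at-starts-differ (suc k) zero    (suc j′) _         _          A =
  ⊥-elim (¬Agree-4a-4b+3 0 (start j′) (Agree-≤ (8≤2+2*4^[1+k] k) A))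
factors-at-starts-differ (suc k) (suc j) zero     _         _          A =
  ⊥-elim (¬Agree-4a-4b+3 0 (start j) (Agree-≤ (8≤2+2*4^[1+k] k) (Agree-sym A)))
factors-at-starts-differ (suc k) (suc j) (suc j′) (s≤s j<k) (s≤s j′<k) A =
  cong suc (factors-at-starts-differ k j j′ j<k j′<k
    (Agree-unμ² ≤-refl (≤-reflexive (length-eq (4 ^ k))) (s≤s z≤n) A))
  where
  length-eq : ∀ x → 4 * (2 + 2 * x) ≡ 3 + (3 + (2 + 2 * (4 * x)))
  length-eq = solve-∀

n<4^n : ∀ n → n < 4 ^ n
n<4^n zero    = s≤s z≤n
n<4^n (suc n) = ≤-trans (s≤s (n<4^n n))
  (subst (_≤ 4 ^ suc n) (+-comm (4 ^ n) 1) (+-monoʳ-≤ (4 ^ n) (≤-trans (s≤s z≤n) (*-monoʳ-≤ 3 (m^n>0 4 n)))))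

many-privileged-factors : (M N : ℕ) → Σ ℕ (λ n → (N ≤ n) × AtLeast M n)
many-privileged-factors M N = n , N≤n , word , word-injective , word-privileged
  where
  K = M + N
  n = 2 + 2 * 4 ^ K
  N≤n : N ≤ n
  N≤n = ≤-trans (m≤n+m N M) (≤-trans (<⇒≤ (n<4^n K)) (≤-trans (m≤n*m (4 ^ K) 2) (m≤n+m _ 2)))
  j<K : (j : Fin M) → toℕ j < K
  j<K j = <-≤-trans (toℕ<n j) (m≤m+n M N)
  word : Fin M → Word
  word j = factor (start (toℕ j)) n
  word-injective : Injective _≡_ _≡_ word
  word-injective {x} {y} eq =
    toℕ-injective (factors-at-starts-differ K (toℕ x) (toℕ y) (j<K x) (j<K y) (factor≡⇒Agree n eq))
  word-privileged : ∀ j → PrivFactor n (word j)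
  word-privileged j =
    length-factor p n ,
    (p , trans (cong (window p) (length-factor p n)) (window≡factor p n)) ,
    Chain-privileged EvenSeed-privileged (even-chain K (toℕ j) (j<K j))
    where p = start (toℕ j)


-- No privileged factor of odd length at least 5

no-early-return : ∀ {p n g k} → FirstReturn p n g → 0 < k → k < g → ¬ Agree (p + k) p n
no-early-return {k = k} R 0<k k<g A with first R k (<⇒≤ k<g) A
... | inj₁ refl = <-irrefl refl 0<k
... | inj₂ refl = <-irrefl refl k<g

first-return-to-ε : ∀ {p g} → FirstReturn p 0 g → g ≡ 1
first-return-to-ε R with first R 1 (gap>0 R) (agree λ _ ())
... | inj₂ 1≡g = sym 1≡g

first-return-to-letter≤3 : ∀ {p g} → FirstReturn p 1 g → g ≤ 3
first-return-to-letter≤3 {p} {g} R with g ≤? 3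
... | yes g≤3 = g≤3
... | no  g≰3 = ⊥-elim (no-aaa (suc p) (trans (flipped 0 z<s) (sym (flipped 1 (s<s z<s))))
                                      (trans (flipped 1 (s<s z<s)) (sym (flipped 2 (s<s (s<s z<s))))))
  where
  flipped : ∀ k → k < 3 → t (suc k + p) ≡ not (t p)
  flipped k k<3 = ¬-not λ eq → no-early-return R z<s (<-≤-trans (s<s k<3) (≰⇒> g≰3))
                                 (Agree-1 (p + suc k) p (subst (λ x → t x ≡ t p) (+-comm (suc k) p) eq))

pair-distance-even : ∀ p g → t p ≡ t (suc p) → t (p + g) ≡ t (suc (p + g)) → ∃ λ h → g ≡ 2 * h
pair-distance-even p g pair₁ pair₂ with pair⇒odd p pair₁ | pair⇒odd (p + g) pair₂ | parity g
... | _ , _    | _  , _  | even h = h , refl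
... | m , refl | m′ , eq | odd h  = ⊥-elim (even≢odd (suc (m + h)) m′ (trans (shift m h) eq))
  where
  shift : ∀ m h → 2 * suc (m + h) ≡ suc (2 * m) + suc (2 * h)
  shift = solve-∀

privileged-factor-return : ∀ {w p L} → Privileged w → factor p L ≡ w → 2 ≤ L →
                           ∃ λ ℓ → ∃ λ g → ℓ + g ≡ L × Privileged (factor p ℓ) × FirstReturn p ℓ g
privileged-factor-return priv-ε           () (s≤s (s≤s _))
privileged-factor-return (priv-letter _)  () (s≤s (s≤s _))
privileged-factor-return (priv-return {v} P _ R) refl _ with CFR⇒FirstReturn R
... | prefix , g , ℓ+g≡L , F = length v , g , ℓ+g≡L , subst Privileged (sym prefix) P , F

privileged-factor₂⇒pair : ∀ p → Privileged (factor p 2) → t p ≡ t (suc p)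
privileged-factor₂⇒pair p P with privileged-factor-return P refl (s≤s (s≤s z≤n))
... | 0 , _ , refl , _ , R with first-return-to-ε R
...   | ()
privileged-factor₂⇒pair p P | 1 , _ , refl , _ , R =
  sym (Agree-at (returns R) z<s (trans (+-identityʳ _) (+-comm p 1)) (+-identityʳ p))
privileged-factor₂⇒pair p P | 2 , 0 , refl , _ , R = ⊥-elim (<-irrefl refl (gap>0 R))

privileged-factor₃⇒aba : ∀ p → Privileged (factor p 3) → t p ≡ t (2 + p)
privileged-factor₃⇒aba p P with privileged-factor-return P refl (s≤s (s≤s z≤n))
... | 0 , _ , refl , _ , R with first-return-to-ε R
...   | ()
privileged-factor₃⇒aba p P | 1 , _ , refl , _ , R =
  sym (Agree-at (returns R) z<s (trans (+-identityʳ _) (+-comm p 2)) (+-identityʳ p))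
privileged-factor₃⇒aba p P | 2 , _ , refl , _ , R = sym (trans
  (Agree-at (returns R) (s<s z<s) (trans (+-assoc p 1 1) (+-comm p 2)) (+-comm p 1))
  (Agree-at (returns R) z<s (trans (+-identityʳ _) (+-comm p 1)) (+-identityʳ p)))
privileged-factor₃⇒aba p P | 3 , 0 , refl , _ , R = ⊥-elim (<-irrefl refl (gap>0 R))

aba⇒pair : ∀ m r → r < 2 → t (2 * m + r) ≡ t (2 + (2 * m + r)) → t m ≡ t (suc m)
aba⇒pair m r r<2 aba = xor-cancelˡ (t r) (begin
  t r xor t m               ≡⟨ sym (t-2x+r m r r<2) ⟩
  t (2 * m + r)             ≡⟨ aba ⟩
  t (2 + (2 * m + r))       ≡⟨ cong t (shift m r) ⟩
  t (2 * suc m + r)         ≡⟨ t-2x+r (suc m) r r<2 ⟩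
  t r xor t (suc m)         ∎)
  where
  open ≡-Reasoning
  shift : ∀ m r → 2 + (2 * m + r) ≡ 2 * suc m + r
  shift = solve-∀

pair⇒aba : ∀ m r → r < 2 → t m ≡ t (suc m) → t (2 * m + r) ≡ t (2 + (2 * m + r))
pair⇒aba m r r<2 pair = begin
  t (2 * m + r)             ≡⟨ t-2x+r m r r<2 ⟩
  t r xor t m               ≡⟨ cong (t r xor_) pair ⟩
  t r xor t (suc m)         ≡⟨ sym (t-2x+r (suc m) r r<2) ⟩
  t (2 * suc m + r)         ≡⟨ cong t (shift m r) ⟩
  t (2 + (2 * m + r))       ∎
  where
  open ≡-Reasoning
  shift : ∀ m r → 2 * suc m + r ≡ 2 + (2 * m + r)
  shift = solve-∀

aba-middle : ∀ x → t x ≡ t (2 + x) → t (suc x) ≡ not (t x)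
aba-middle x aba = ¬-not λ eq → no-aaa x (sym eq) (trans eq aba)

aba-Agree : ∀ x y → t x ≡ t (2 + x) → t y ≡ t (2 + y) → t y ≡ t x → Agree y x 3
aba-Agree x y aba-x aba-y eq = agree λ
  { 0 _ → at-offset 0 eq
  ; 1 _ → at-offset 1 (trans (aba-middle y aba-y) (trans (cong not eq) (sym (aba-middle x aba-x))))
  ; 2 _ → at-offset 2 (trans (sym aba-y) (trans eq aba-x))
  ; (suc (suc (suc _))) (s≤s (s≤s (s≤s ()))) }
  where
  at-offset : ∀ k → t (k + y) ≡ t (k + x) → t (y + k) ≡ t (x + k)
  at-offset k = t-resp (+-comm k y) (+-comm k x)

equal-at-odd-distance⇒adjacent-equal : ∀ (f : ℕ → Bool) s h → f s ≡ f (suc (2 * h) + s) →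
                                       ∃ λ o → o ≤ 2 * h × f (o + s) ≡ f (suc (o + s))
equal-at-odd-distance⇒adjacent-equal f s zero    eq = 0 , z≤n , eq
equal-at-odd-distance⇒adjacent-equal f s (suc h) eq with f s ≟ᵇ f (suc s) | f (suc s) ≟ᵇ f (2 + s)
... | yes eq₀ | _       = 0 , z≤n , eq₀
... | no _    | yes eq₁ = 1 , s≤s z≤n , eq₁
... | no ne₀  | no ne₁
  with equal-at-odd-distance⇒adjacent-equal f (2 + s) h (trans f2+s≡fs (trans eq (cong f (shift s h))))
  where
  f2+s≡fs : f (2 + s) ≡ f s
  f2+s≡fs = sym (trans (¬-not ne₀) (trans (cong not (¬-not ne₁)) (not-involutive _)))
  shift : ∀ s h → suc (2 * suc h) + s ≡ suc (2 * h) + (2 + s)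
  shift = solve-∀
...   | o , o≤2h , eq₂ = 2 + o , subst (2 + o ≤_) (sym (*-suc 2 h)) (s≤s (s≤s o≤2h)) ,
                         subst (λ x → f x ≡ f (suc x)) (trans (+-suc o (suc s)) (cong suc (+-suc o s))) eq₂

-- Pairs sit at odd positions, so d is even; if the letters strictly between the two pairs
-- alternated, the letter at m + d would differ from the one at m.
pair-between : ∀ m d → t m ≡ t (suc m) → t (m + d) ≡ t (suc (m + d)) → t m ≡ t (m + d) → 0 < d →
               ∃ λ o → m < o × o < m + d × t o ≡ t (suc o)
pair-between m d pair₁ pair₂ same 0<d with pair-distance-even m d pair₁ pair₂
... | zero  , refl = ⊥-elim (<-irrefl refl 0<d)
... | suc h , refl
  with equal-at-odd-distance⇒adjacent-equal t (suc m) h (trans (sym pair₁) (trans same (cong t (shift m h))))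
  where
  shift : ∀ m h → m + 2 * suc h ≡ suc (2 * h) + suc m
  shift = solve-∀
...   | o , o≤2h , pair = o + suc m , m<o , o<m+d , pair
  where
  m<o : m < o + suc m
  m<o = subst (m <_) (sym (+-suc o m)) (s≤s (m≤n+m m o))
  o<m+d : o + suc m < m + 2 * suc h
  o<m+d = subst (suc (o + suc m) ≤_) (shift m h) (s≤s (+-monoˡ-≤ (suc m) o≤2h))
    where
    shift : ∀ m h → suc (2 * h + suc m) ≡ m + 2 * suc h
    shift = solve-∀

letter-at-2o-or-2o+1 : ∀ o a → ∃ λ r → r < 2 × t (2 * o + r) ≡ a
letter-at-2o-or-2o+1 o a with t o ≟ᵇ a
... | yes eq = 0 , z<s , trans (t-2x+r o 0 z<s) eq
... | no  ne = 1 , s<s z<s , trans (t-2x+r o 1 (s<s z<s)) (trans (cong not (¬-not ne)) (not-involutive a))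

2m+r<2o+r′ : ∀ {m o r r′} → m < o → r < 2 → 2 * m + r < 2 * o + r′
2m+r<2o+r′ {m} {o} {r} {r′} m<o r<2 = begin-strict
  2 * m + r   <⟨ +-monoʳ-< (2 * m) r<2 ⟩
  2 * m + 2   ≡⟨ trans (+-comm (2 * m) 2) (sym (*-suc 2 m)) ⟩
  2 * suc m   ≤⟨ *-monoʳ-≤ 2 m<o ⟩
  2 * o       ≤⟨ m≤m+n (2 * o) r′ ⟩
  2 * o + r′  ∎
  where open ≤-Reasoning

aba-pair-between : ∀ m r d → r < 2 → 0 < d → t (2 * m + r) ≡ t (2 + (2 * m + r)) →
                   Agree (2 * (m + d) + r) (2 * m + r) 3 → ∃ λ o → m < o × o < m + d × t o ≡ t (suc o)
aba-pair-between m r d r<2 0<d aba A =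
  pair-between m d (aba⇒pair m r r<2 aba) (aba⇒pair (m + d) r r<2 aba′) same 0<d
  where
  p  = 2 * m + r
  p′ = 2 * (m + d) + r
  letter : t p′ ≡ t p
  letter = Agree-at A z<s (+-identityʳ p′) (+-identityʳ p)
  aba′ : t p′ ≡ t (2 + p′)
  aba′ = trans letter (trans aba (sym (Agree-at A (s<s (s<s z<s)) (+-comm p′ 2) (+-comm p 2))))
  same : t m ≡ t (m + d)
  same = xor-cancelˡ (t r) (trans (sym (t-2x+r m r r<2)) (trans (sym letter) (t-2x+r (m + d) r r<2)))

-- An occurrence of aba at 2m + r corresponds to a pair at m; a pair strictly between the pairs of
-- the two occurrences gives an occurrence of aba strictly between them.
no-even-first-return-to-aba-at-2m+r : ∀ m r h → r < 2 → t (2 * m + r) ≡ t (2 + (2 * m + r)) →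
                                      ¬ FirstReturn (2 * m + r) 3 (2 * suc h)
no-even-first-return-to-aba-at-2m+r m r h r<2 aba R
  with aba-pair-between m r (suc h) r<2 z<s aba (Agree-cong (shift m r h) refl (returns R))
  where
  shift : ∀ m r h → 2 * m + r + 2 * suc h ≡ 2 * (m + suc h) + r
  shift = solve-∀
... | o , m<o , o<m+d , pair with letter-at-2o-or-2o+1 o (t (2 * m + r))
...   | r′ , r′<2 , letter with m≤n⇒∃[o]m+o≡n (2m+r<2o+r′ {r′ = r′} m<o r<2)
...     | k , p+1+k≡x = no-early-return R z<s k<g (Agree-cong (sym p+k≡x) refl
            (aba-Agree (2 * m + r) (2 * o + r′) aba (pair⇒aba o r′ r′<2 pair) letter))
  where
  p+k≡x : 2 * m + r + suc k ≡ 2 * o + r′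
  p+k≡x = trans (+-suc (2 * m + r) k) p+1+k≡x
  k<g : suc k < 2 * suc h
  k<g = +-cancelˡ-< (2 * m + r) _ _ (subst₂ _<_ (sym p+k≡x) (shift m r h) (2m+r<2o+r′ o<m+d r′<2))
    where
    shift : ∀ m r h → 2 * (m + suc h) + r ≡ 2 * m + r + 2 * suc h
    shift = solve-∀

p≡2*[p/2]+p%2 : ∀ p → p ≡ 2 * (p / 2) + p % 2
p≡2*[p/2]+p%2 p = trans (m≡m%n+[m/n]*n p 2) (reorder (p % 2) (p / 2))
  where
  reorder : ∀ r q → r + q * 2 ≡ 2 * q + r
  reorder = solve-∀

no-even-first-return-to-aba : ∀ p h → t p ≡ t (2 + p) → ¬ FirstReturn p 3 (2 * suc h)
no-even-first-return-to-aba p h =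
  subst (λ x → t x ≡ t (2 + x) → ¬ FirstReturn x 3 (2 * suc h)) (sym (p≡2*[p/2]+p%2 p))
    (no-even-first-return-to-aba-at-2m+r (p / 2) (p % 2) h (m%n<n p 2))

5+2h≡1+2[2+h] : ∀ h → 5 + 2 * h ≡ suc (2 * (2 + h))
5+2h≡1+2[2+h] = solve-∀

odd-privileged-returns-to-odd : ∀ {p ℓ g h} → Privileged (factor p ℓ) → FirstReturn p ℓ g → ℓ + g ≡ 5 + 2 * h →
                                ∃ λ h′ → ℓ ≡ 5 + 2 * h′
odd-privileged-returns-to-odd {ℓ = 0} _ R eq with first-return-to-ε R | eq
... | refl | ()
odd-privileged-returns-to-odd {ℓ = 1} {h = h} _ R eq =
  ⊥-elim (≤⇒≯ (first-return-to-letter≤3 R) (subst (3 <_) (sym (suc-injective eq)) (m≤m+n 4 (2 * h))))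
odd-privileged-returns-to-odd {p} {2} {g} {h} P R eq
  with pair-distance-even p g (privileged-factor₂⇒pair p P) pair-after-gap
  where
  pair-after-gap : t (p + g) ≡ t (suc (p + g))
  pair-after-gap = trans (Agree-at (returns R) z<s (+-identityʳ (p + g)) (+-identityʳ p))
    (trans (privileged-factor₂⇒pair p P) (sym (Agree-at (returns R) (s<s z<s) (+-comm (p + g) 1) (+-comm p 1))))
... | g′ , refl = ⊥-elim (even≢odd (suc g′) (2 + h) (trans (shift g′) (trans eq (5+2h≡1+2[2+h] h))))
  where
  shift : ∀ g′ → 2 * suc g′ ≡ 2 + 2 * g′
  shift = solve-∀
odd-privileged-returns-to-odd {p} {3} {g} {h} P R eq =
  ⊥-elim (no-even-first-return-to-aba p h (privileged-factor₃⇒aba p P) (subst (FirstReturn p 3) (gap g h eq) R))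
  where
  gap : ∀ g h → 3 + g ≡ 5 + 2 * h → g ≡ 2 * suc h
  gap g h eq = trans (suc-injective (suc-injective (suc-injective eq))) (sym (*-suc 2 h))
odd-privileged-returns-to-odd {p} {suc (suc (suc (suc ℓ′)))} {g} {h} _ R eq
  with period-even p g (Agree-≤ (s≤s (s≤s (s≤s (s≤s z≤n)))) (returns R)) | parity ℓ′
... | g′ , refl | odd m  = m , refl
... | g′ , refl | even m =
  ⊥-elim (even≢odd (2 + (m + g′)) (2 + h) (trans (shift m g′) (trans eq (5+2h≡1+2[2+h] h))))
  where
  shift : ∀ m g′ → 2 * (2 + (m + g′)) ≡ 4 + 2 * m + 2 * g′
  shift = solve-∀

no-privileged-factor-of-odd-length : ∀ {w} → Privileged w → ∀ p h → factor p (5 + 2 * h) ≢ w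
no-privileged-factor-of-odd-length (priv-return {v} P _ R) p h refl with CFR⇒FirstReturn R
... | prefix , g , ℓ+g≡L , F
  with odd-privileged-returns-to-odd {h = h} (subst Privileged (sym prefix) P) F ℓ+g≡L
...   | h′ , ℓ≡ = no-privileged-factor-of-odd-length P p h′ (trans (cong (factor p) (sym ℓ≡)) prefix)

no-privileged-factors : (N : ℕ) → Σ ℕ (λ n → (N ≤ n) × IsZero n)
no-privileged-factors N = n , ≤-trans (m≤n*m N 2) (m≤n+m (2 * N) 5) , no-factor
  where
  n = 5 + 2 * N
  no-factor : IsZero n
  no-factor w (∣w∣≡n , (p , window≡w) , P) = no-privileged-factor-of-odd-length P p N (begin
    factor p n             ≡⟨ sym (window≡factor p n) ⟩
    window p n             ≡⟨ cong (window p) (sym ∣w∣≡n) ⟩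
    window p (length w)    ≡⟨ window≡w ⟩
    w                      ∎)
    where open ≡-Reasoning

proposition4p22 :
  ((M N : ℕ) → Σ ℕ (λ n → (N ≤ n) × AtLeast M n)) ×
  ((N : ℕ) → Σ ℕ (λ n → (N ≤ n) × IsZero n))
proposition4p22 = many-privileged-factors , no-privileged-factors
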